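{- Let $I$ be a nonempty set, let $z_i,w_i\in M$ for $i\in I$, and let $\mathbf{R}=\bigcup\{pr(\langle\langle z_i,w_i\rangle\rangle):i\in I\}$. Then $dom(\mathbf{R})=\bigcup\{pr(z_i):i\in I\}$ and $ran(\mathbf{R})=\bigcup\{pr(w_i):i\in I\}$.
   Context: Work in ZFA, i.e. ZF with a set $A$ of atoms. Fix a preorder $\preccurlyeq$ on $A$ with no minimal elements: for every $a\in A$ there is $b\in A$ with $b\preccurlyeq a$ and $a\not\preccurlyeq b$. For $a\in A$ let $pr(a)=\{b\in A:b\preccurlyeq a\}$. Define the magmatic hierarchy: $M_1$ is the set of nonempty subsets $x\subseteq A$ that are downward closed ($a\in x$ and $b\preccurlyeq a$ imply $b\in x$); for $\alpha\geq 1$, $M_{\alpha+1}$ is the set of nonempty $x\subseteq M_\alpha$ such that for every $y\in x$, every $z\in M_\alpha$ with $z\subseteq y$ belongs to $x$; $M_\lambda=\bigcup_{1\leq\beta<\lambda}M_\beta$ for limit $\lambda$; $M=\bigcup_{\alpha\geq1}M_\alpha$. For $x\in M$ let $pr(x)=\{y\in M:y\subseteq x\}$, and $pr^2=pr\circ pr$. Fix two atoms $a_0,a_1\in A$ incomparable under $\preccurlyeq$. For $x,y\in M$ the magmatic pair is $\langle\langle x,y\rangle\rangle:=pr(pr^2(x)\cup pr^2(a_0))\cup pr(pr^2(y)\cup pr^2(a_1))$. For a magma $\mathbf{R}$, $dom(\mathbf{R})=\bigcup\{pr(z):z\in M,\ \exists w\in M\,(pr(\langle\langle z,w\rangle\rangle)\subseteq\mathbf{R})\}$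 and $ran(\mathbf{R})=\bigcup\{pr(w):w\in M,\ \exists z\in M\,(pr(\langle\langle z,w\rangle\rangle)\subseteq\mathbf{R})\}$. -}

module Defs where

-- A model of ZFA (ZF with a set of atoms), given abstractly as a structure
-- (U, ∈, Atom) satisfying the ZFA axioms (schemas are taken over all Agda
-- predicates / functions), together with classical logic.

open import Data.Product using (Σ; ∃; _×_; _,_)
open import Data.Sum using (_⊎_)
open import Relation.Nullary using (¬_; Dec)
open import Relation.Binary.PropositionalEquality using (_≡_)
open import Induction.WellFounded using (WellFounded)

infix 2 _⟺_
_⟺_ : Set → Set → Set
P ⟺ Q = (P → Q) × (Q → P)

record ZFA : Set₁ where
  infix 4 _∈_
  field
    U    : Set
    _∈_  : U → U → Set
    Atom : U → Set
    atom-empty : ∀ a → Atom a → ∀ x → ¬ (x ∈ a)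
    extensionality : ∀ x y → ¬ Atom x → ¬ Atom y → (∀ z → (z ∈ x) ⟺ (z ∈ y)) → x ≡ y
    foundation : WellFounded (λ y x → y ∈ x)
    emptyset : ∃ λ e → ¬ Atom e × (∀ z → ¬ (z ∈ e))
    pairing : ∀ x y → ∃ λ p → ¬ Atom p × (∀ z → (z ∈ p) ⟺ (z ≡ x ⊎ z ≡ y))
    union : ∀ x → ∃ λ u → ¬ Atom u × (∀ z → (z ∈ u) ⟺ (∃ λ y → y ∈ x × z ∈ y))
    power : ∀ x → ∃ λ p → ¬ Atom p ×
              (∀ z → (z ∈ p) ⟺ (¬ Atom z × (∀ u → u ∈ z → u ∈ x)))
    separation : (P : U → Set) → ∀ x → ∃ λ s → ¬ Atom s × (∀ z → (z ∈ s) ⟺ (z ∈ x × P z))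
    replacement : (F : U → U) → ∀ x → ∃ λ r → ¬ Atom r ×
                    (∀ z → (z ∈ r) ⟺ (∃ λ y → y ∈ x × z ≡ F y))
    infinity : ∃ λ w → ¬ Atom w ×
                 (∃ λ e → e ∈ w × ¬ Atom e × (∀ z → ¬ (z ∈ e))) ×
                 (∀ x → x ∈ w → ∃ λ s → s ∈ w × ¬ Atom s × (∀ z → (z ∈ s) ⟺ (z ∈ x ⊎ z ≡ x)))
    atom-set : ∃ λ A → ¬ Atom A × (∀ z → (z ∈ A) ⟺ Atom z)
    excluded-middle : (P : Set) → Dec P

module Basic (Z : ZFA) where
  open ZFA Z public

  infix 4 _⊆_
  _⊆_ : U → U → Set
  x ⊆ y = ∀ u → u ∈ x → u ∈ y

  NonEmpty : U → Set
  NonEmpty x = ∃ λ u → u ∈ x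

  IsEmptySet : U → Set
  IsEmptySet x = ¬ Atom x × (∀ z → ¬ (z ∈ x))

  Transitive : U → Set
  Transitive x = ¬ Atom x × (∀ y → y ∈ x → ∀ z → z ∈ y → z ∈ x)

  -- von Neumann ordinals (transitive sets of transitive sets; ∈ is well-founded)
  Ordinal : U → Set
  Ordinal α = Transitive α × (∀ β → β ∈ α → Transitive β)

  IsOne : U → Set
  IsOne α = ¬ Atom α × (∀ x → (x ∈ α) ⟺ IsEmptySet x)

  IsSucc : U → U → Set
  IsSucc α β = ¬ Atom β × (∀ x → (x ∈ β) ⟺ (x ∈ α ⊎ x ≡ α))

  IsLimit : U → Set
  IsLimit λ' = Ordinal λ' × NonEmpty λ' × (∀ α → α ∈ λ' → ∃ λ β → β ∈ λ' × α ∈ β)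

module Hier (Z : ZFA) (_≼_ : ZFA.U Z → ZFA.U Z → Set) where
  open Basic Z

  M₁-cond : U → Set
  M₁-cond x = ¬ Atom x × NonEmpty x × (∀ a → a ∈ x → Atom a) ×
              (∀ a b → a ∈ x → Atom b → b ≼ a → b ∈ x)

  -- x ∈ M_{α+1}, given the predicate P = (· ∈ M_α)
  Msucc-cond : (U → Set) → U → Set
  Msucc-cond P x = ¬ Atom x × NonEmpty x × (∀ y → y ∈ x → P y) ×
                   (∀ y z → y ∈ x → P z → z ⊆ y → z ∈ x)

  -- A family Mst α (the class M_α, for ordinals α ≥ 1) satisfying the
  -- defining transfinite recursion clauses (this determines it uniquely).
  record Hierarchy : Set₁ where
    field
      Mst : U → U → Set
      clause-one : ∀ α → IsOne α → ∀ x → Mst α x ⟺ M₁-cond x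
      clause-succ : ∀ α β → Ordinal α → NonEmpty α → IsSucc α β →
                    ∀ x → Mst β x ⟺ Msucc-cond (Mst α) x
      clause-limit : ∀ λ' → IsLimit λ' →
                     ∀ x → Mst λ' x ⟺ (∃ λ β → β ∈ λ' × NonEmpty β × Mst β x)

record Setup : Set₁ where
  field
    Z : ZFA
  open ZFA Z
  field
    _≼_ : U → U → Set
    ≼-refl  : ∀ a → Atom a → a ≼ a
    ≼-trans : ∀ a b c → Atom a → Atom b → Atom c → a ≼ b → b ≼ c → a ≼ c
    no-minimal : ∀ a → Atom a → ∃ λ b → Atom b × b ≼ a × ¬ (a ≼ b)
    H : Hier.Hierarchy Z _≼_
    a₀ a₁ : U
    a₀-atom : Atom a₀
    a₁-atom : Atom a₁
    a₀⋠a₁ : ¬ (a₀ ≼ a₁)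
    a₁⋠a₀ : ¬ (a₁ ≼ a₀)

module Magmatic (S : Setup) where
  open Setup S using (Z; _≼_; H; a₀; a₁)
  open Basic Z public
  open Hier Z _≼_ public
  open Hierarchy H public

  M : U → Set
  M x = ∃ λ α → Ordinal α × NonEmpty α × Mst α x

  -- classes (sets are handled through their membership predicate)
  Class : Set₁
  Class = U → Set

  el : U → Class
  el x = λ u → u ∈ x

  _∪_ : Class → Class → Class
  (C ∪ D) u = C u ⊎ D u

  _⊆C_ : Class → Class → Set
  C ⊆C D = ∀ u → C u → D u

  pr : Class → Class
  pr C y = M y × (∀ u → u ∈ y → C u)

  prA : U → Class
  prA a b = Atom b × b ≼ a

  pr² : U → Class
  pr² x = pr (pr (el x))

  pr²A : U → Class
  pr²A a = pr (prA a)

  ⟪_,_⟫ : U → U → Class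
  ⟪ x , y ⟫ = pr (pr² x ∪ pr²A a₀) ∪ pr (pr² y ∪ pr²A a₁)

  dom : Class → Class
  dom R u = ∃ λ z → M z × (∃ λ w → M w × (pr ⟪ z , w ⟫ ⊆C R)) × pr (el z) u

  ran : Class → Class
  ran R u = ∃ λ w → M w × (∃ λ z → M z × (pr ⟪ z , w ⟫ ⊆C R)) × pr (el w) u

-- For ⊆, let u ∈ pr(x) with pr⟨⟨x,x′⟩⟩ ⊆ R
-- (or pr⟨⟨x′,x⟩⟩ ⊆ R), and let a be the atom tagging the coordinate of x.
-- If u ∈ M_α, then t = {s ∈ M_α : s ⊆ u} ∈ M_{α+1} and t₀ = pr(a) ∈ M_1; both
-- lie in M_λ for a limit λ > α+1 (levels only accumulate at limits), so
-- v = {s ∈ M_λ : s ⊆ t or s ⊆ t₀} ∈ M_{λ+1} and y = {s ∈ M_{λ+1} : s ⊆ v}.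
-- Then y ∈ pr⟨⟨x,x′⟩⟩ ⊆ R, so y ∈ pr⟨⟨z_i,w_i⟩⟩ for some i and v lies in one
-- half of that pair. Atoms are not in M and a₀, a₁ are incomparable, so
-- a ∈ t₀ ∈ v forces v into the half tagged by a, where u ∈ t ∈ v gives u ⊆ z_i
-- (resp. u ⊆ w_i).
{-# OPTIONS --safe #-}
module Submission where

open import Defs
open import Data.Empty using (⊥-elim)
open import Data.Nat.Base using (ℕ; zero; suc)
open import Data.Nat.GeneralisedArithmetic using (fold)
open import Data.Product using (∃; _×_; _,_; proj₁; proj₂)
open import Data.Sum using (_⊎_; inj₁; inj₂; [_,_]′; reduce; swap)
import Data.Sum as Sum
open import Induction.WellFounded using (Acc; acc)
open import Relation.Nullary using (¬_; Dec; yes; no)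
open import Relation.Binary.PropositionalEquality using (_≡_; refl; sym; cong; subst)

module SetTheory (Z : ZFA) where
  open Basic Z

  stable : ∀ {P : Set} → ¬ ¬ P → P
  stable {P} ¬¬p with excluded-middle P
  ... | yes p = p
  ... | no ¬p = ⊥-elim (¬¬p ¬p)

  ∈-irrefl : ∀ x → ¬ (x ∈ x)
  ∈-irrefl x = go (foundation x)
    where
    go : ∀ {x} → Acc _∈_ x → ¬ (x ∈ x)
    go (acc rs) x∈x = go (rs x∈x) x∈x

  ⊆-refl : ∀ {x} → x ⊆ x
  ⊆-refl _ z∈x = z∈x

  ⊆-trans : ∀ {x y z} → x ⊆ y → y ⊆ z → x ⊆ z
  ⊆-trans x⊆y y⊆z u u∈x = y⊆z u (x⊆y u u∈x)

  ⊆-antisym : ∀ {x y} → ¬ Atom x → ¬ Atom y → x ⊆ y → y ⊆ x → x ≡ y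
  ⊆-antisym {x} {y} x-set y-set x⊆y y⊆x =
    extensionality x y x-set y-set (λ z → x⊆y z , y⊆x z)

  IsEmptySet-unique : ∀ {x y} → IsEmptySet x → IsEmptySet y → x ≡ y
  IsEmptySet-unique (x-set , x-empty) (y-set , y-empty) =
    ⊆-antisym x-set y-set (λ z z∈x → ⊥-elim (x-empty z z∈x)) (λ z z∈y → ⊥-elim (y-empty z z∈y))

  ∈-trans : ∀ {x y z} → Transitive x → z ∈ y → y ∈ x → z ∈ x
  ∈-trans (_ , x-trans) z∈y y∈x = x-trans _ y∈x _ z∈y

  -- The ZFA axioms of Defs, as well as IsSucc and IsOne, are stated in this form.
  IsSetOf : (U → Set) → U → Set
  IsSetOf P s = ¬ Atom s × (∀ z → z ∈ s ⟺ P z)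

  SetOf : (U → Set) → Set
  SetOf P = ∃ (IsSetOf P)

  ∈-intro : ∀ {P s z} → IsSetOf P s → P z → z ∈ s
  ∈-intro (_ , members) = proj₂ (members _)

  ∈-elim : ∀ {P s z} → IsSetOf P s → z ∈ s → P z
  ∈-elim (_ , members) = proj₁ (members _)

  IsSetOf-unique : ∀ {P s s′} → IsSetOf P s → IsSetOf P s′ → s ≡ s′
  IsSetOf-unique s-is@(s-set , _) s′-is@(s′-set , _) =
    ⊆-antisym s-set s′-set (λ z z∈s → ∈-intro s′-is (∈-elim s-is z∈s))
                           (λ z z∈s′ → ∈-intro s-is (∈-elim s′-is z∈s′))

  SetOf-⟺ : ∀ {P Q} → (∀ z → P z ⟺ Q z) → SetOf P → SetOf Q
  SetOf-⟺ P⟺Q (s , s-set , members) =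
    s , s-set , λ z → (λ z∈s → proj₁ (P⟺Q z) (proj₁ (members z) z∈s))
                    , (λ q → proj₂ (members z) (proj₂ (P⟺Q z) q))

  binary-union : ∀ x y → SetOf (λ z → z ∈ x ⊎ z ∈ y)
  binary-union x y with pairing x y
  ... | p , p-is = SetOf-⟺ (λ z → to z , from z) (union p)
    where
    to : ∀ z → (∃ λ s → s ∈ p × z ∈ s) → z ∈ x ⊎ z ∈ y
    to z (s , s∈p , z∈s) with ∈-elim p-is s∈p
    ... | inj₁ refl = inj₁ z∈s
    ... | inj₂ refl = inj₂ z∈s
    from : ∀ z → z ∈ x ⊎ z ∈ y → ∃ λ s → s ∈ p × z ∈ s
    from z (inj₁ z∈x) = x , ∈-intro p-is (inj₁ refl) , z∈x
    from z (inj₂ z∈y) = y , ∈-intro p-is (inj₂ refl) , z∈y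

  ⊆-∪ : ∀ {x y u s} → IsSetOf (λ z → z ∈ x ⊎ z ∈ y) u → s ⊆ x ⊎ s ⊆ y → s ⊆ u
  ⊆-∪ u-is (inj₁ s⊆x) z z∈s = ∈-intro u-is (inj₁ (s⊆x z z∈s))
  ⊆-∪ u-is (inj₂ s⊆y) z z∈s = ∈-intro u-is (inj₂ (s⊆y z z∈s))

  successor : ∀ x → SetOf (λ z → z ∈ x ⊎ z ≡ x)
  successor x with pairing x x
  ... | s , s-is = SetOf-⟺ (λ z → Sum.map₂ (λ z∈s → reduce (∈-elim s-is z∈s)) ,
                                   Sum.map₂ (λ z≡x → ∈-intro s-is (inj₁ z≡x)))
                            (binary-union x s)

  infix 10 _⁺
  _⁺ : U → U
  x ⁺ = proj₁ (successor x)

  IsSucc-⁺ : ∀ x → IsSucc x (x ⁺)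
  IsSucc-⁺ x = proj₂ (successor x)

  ∈-⁺ : ∀ {x} → x ∈ x ⁺
  ∈-⁺ {x} = ∈-intro (IsSucc-⁺ x) (inj₂ refl)

  -- Every set whose members are atoms or subsets of b lies in A ∪ 𝒫(b).
  comprehension : (P : U → Set) (b : U) → (∀ {s} → P s → s ⊆ b) → SetOf P
  comprehension P b bounded with atom-set | power b
  ... | A , A-is | 𝒫b , 𝒫b-is with binary-union A 𝒫b
  ...   | C , C-is = SetOf-⟺ (λ s → proj₂ , λ p → ∈-intro C-is (candidate p) , p) (separation P C)
    where
    candidate : ∀ {s} → P s → s ∈ A ⊎ s ∈ 𝒫b
    candidate {s} p with excluded-middle (Atom s)
    ... | yes s-atom = inj₁ (∈-intro A-is s-atom)
    ... | no s-set = inj₂ (∈-intro 𝒫b-is (s-set , bounded p))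

  ∅ : U
  ∅ = proj₁ emptyset

  ∅-empty : IsEmptySet ∅
  ∅-empty = proj₂ emptyset

  Ordinal-∈ : ∀ {α β} → Ordinal α → β ∈ α → Ordinal β
  Ordinal-∈ (α-trans , α-elems) β∈α =
    α-elems _ β∈α , λ γ γ∈β → α-elems γ (∈-trans α-trans γ∈β β∈α)

  Ordinal-set : ∀ {α} → Ordinal α → ¬ Atom α
  Ordinal-set ((α-set , _) , _) = α-set

  Ordinal-∅ : Ordinal ∅
  Ordinal-∅ = (proj₁ ∅-empty , λ y y∈∅ → ⊥-elim (proj₂ ∅-empty y y∈∅))
            , λ y y∈∅ → ⊥-elim (proj₂ ∅-empty y y∈∅)

  Ordinal-⁺ : ∀ {α} → Ordinal α → Ordinal (α ⁺)
  Ordinal-⁺ {α} (α-trans , α-elems) = (proj₁ (IsSucc-⁺ α) , ⁺-trans) , ⁺-elems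
    where
    ⁺-trans : ∀ y → y ∈ α ⁺ → ∀ z → z ∈ y → z ∈ α ⁺
    ⁺-trans y y∈α⁺ z z∈y with ∈-elim (IsSucc-⁺ α) y∈α⁺
    ... | inj₁ y∈α = ∈-intro (IsSucc-⁺ α) (inj₁ (∈-trans α-trans z∈y y∈α))
    ... | inj₂ refl = ∈-intro (IsSucc-⁺ α) (inj₁ z∈y)
    ⁺-elems : ∀ y → y ∈ α ⁺ → Transitive y
    ⁺-elems y y∈α⁺ with ∈-elim (IsSucc-⁺ α) y∈α⁺
    ... | inj₁ y∈α = α-elems y y∈α
    ... | inj₂ refl = α-trans

  Ordinal-fold : ∀ {γ} → Ordinal γ → ∀ k → Ordinal (fold γ _⁺ k)
  Ordinal-fold oγ zero = oγ
  Ordinal-fold oγ (suc k) = Ordinal-⁺ (Ordinal-fold oγ k)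

  Ordinal-⋃ : ∀ {L} → ¬ Atom L → (∀ {γ} → γ ∈ L → ∃ λ δ → Ordinal δ × γ ∈ δ × δ ⊆ L) → Ordinal L
  Ordinal-⋃ L-set covered =
      (L-set , λ y y∈L z z∈y → let (δ , oδ , y∈δ , δ⊆L) = covered y∈L in
                               δ⊆L z (∈-trans (proj₁ oδ) z∈y y∈δ))
    , λ y y∈L → let (δ , oδ , y∈δ , _) = covered y∈L in proj₂ oδ y y∈δ

  Ordinal-∪ : ∀ {α β δ} → Ordinal α → Ordinal β → IsSetOf (λ z → z ∈ α ⊎ z ∈ β) δ → Ordinal δ
  Ordinal-∪ {α} {β} {δ} oα oβ δ-is = Ordinal-⋃ (proj₁ δ-is) λ γ∈δ → case (∈-elim δ-is γ∈δ)
    where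
    case : ∀ {γ} → γ ∈ α ⊎ γ ∈ β → ∃ λ ε → Ordinal ε × γ ∈ ε × ε ⊆ δ
    case (inj₁ γ∈α) = _ , oα , γ∈α , λ z z∈α → ∈-intro δ-is (inj₁ z∈α)
    case (inj₂ γ∈β) = _ , oβ , γ∈β , λ z z∈β → ∈-intro δ-is (inj₂ z∈β)

  trichotomy : ∀ {α β} → Ordinal α → Ordinal β → α ∈ β ⊎ α ≡ β ⊎ β ∈ α
  trichotomy {α} {β} = go (foundation α) (foundation β)
    where
    go : ∀ {α β} → Acc _∈_ α → Acc _∈_ β → Ordinal α → Ordinal β → α ∈ β ⊎ α ≡ β ⊎ β ∈ α
    go {α} {β} (acc rα) (acc rβ) oα oβ with excluded-middle (α ∈ β) | excluded-middle (β ∈ α)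
    ... | yes α∈β | _ = inj₁ α∈β
    ... | no _ | yes β∈α = inj₂ (inj₂ β∈α)
    ... | no α∉β | no β∉α = inj₂ (inj₁ (⊆-antisym (Ordinal-set oα) (Ordinal-set oβ) α⊆β β⊆α))
      where
      α⊆β : α ⊆ β
      α⊆β γ γ∈α with go (rα γ∈α) (acc rβ) (Ordinal-∈ oα γ∈α) oβ
      ... | inj₁ γ∈β = γ∈β
      ... | inj₂ (inj₁ refl) = ⊥-elim (β∉α γ∈α)
      ... | inj₂ (inj₂ β∈γ) = ⊥-elim (β∉α (∈-trans (proj₁ oα) β∈γ γ∈α))
      β⊆α : β ⊆ α
      β⊆α γ γ∈β with go (acc rα) (rβ γ∈β) oα (Ordinal-∈ oβ γ∈β)
      ... | inj₁ α∈γ = ⊥-elim (α∉β (∈-trans (proj₁ oβ) α∈γ γ∈β))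
      ... | inj₂ (inj₁ refl) = ⊥-elim (α∉β γ∈β)
      ... | inj₂ (inj₂ γ∈α) = γ∈α

  IsOne-⁺ : ∀ {γ α} → IsEmptySet γ → IsSucc γ α → IsOne α
  IsOne-⁺ {α = α} γ-empty α-is = proj₁ α-is , λ x → to , from
    where
    to : ∀ {x} → x ∈ α → IsEmptySet x
    to x∈α with ∈-elim α-is x∈α
    ... | inj₁ x∈γ = ⊥-elim (proj₂ γ-empty _ x∈γ)
    ... | inj₂ refl = γ-empty
    from : ∀ {x} → IsEmptySet x → x ∈ α
    from x-empty = ∈-intro α-is (inj₂ (IsEmptySet-unique x-empty γ-empty))

  data Shape (α : U) : Set where
    one   : IsOne α → Shape α
    succ  : ∀ {γ} → Ordinal γ → NonEmpty γ → IsSucc γ α → Shape α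
    limit : IsLimit α → Shape α

  shape : ∀ {α} → Ordinal α → NonEmpty α → Shape α
  shape {α} oα α-ne with excluded-middle (∃ λ γ → γ ∈ α × ∀ β → β ∈ α → ¬ (γ ∈ β))
  ... | no no-max = limit (oα , α-ne , λ γ γ∈α → stable λ ¬up →
                      no-max (γ , γ∈α , λ β β∈α γ∈β → ¬up (β , β∈α , γ∈β)))
  ... | yes (γ , γ∈α , γ-max) = succ-or-one (excluded-middle (NonEmpty γ))
    where
    oγ = Ordinal-∈ oα γ∈α
    α-is : IsSucc γ α
    α-is = Ordinal-set oα , λ x → to , from
      where
      to : ∀ {x} → x ∈ α → x ∈ γ ⊎ x ≡ γ
      to x∈α with trichotomy (Ordinal-∈ oα x∈α) oγ
      ... | inj₁ x∈γ = inj₁ x∈γ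
      ... | inj₂ (inj₁ x≡γ) = inj₂ x≡γ
      ... | inj₂ (inj₂ γ∈x) = ⊥-elim (γ-max _ x∈α γ∈x)
      from : ∀ {x} → x ∈ γ ⊎ x ≡ γ → x ∈ α
      from (inj₁ x∈γ) = ∈-trans (proj₁ oα) x∈γ γ∈α
      from (inj₂ refl) = γ∈α
    succ-or-one : Dec (NonEmpty γ) → Shape α
    succ-or-one (yes γ-ne) = succ oγ γ-ne α-is
    succ-or-one (no γ-empty) = one (IsOne-⁺ (Ordinal-set oγ , λ z z∈γ → γ-empty (z , z∈γ)) α-is)

  ∅⁺-IsOne : IsOne (∅ ⁺)
  ∅⁺-IsOne = IsOne-⁺ ∅-empty (IsSucc-⁺ ∅)

  numeral : ℕ → U
  numeral = fold ∅ _⁺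

  numerals-bounded : ∃ λ w → ∀ k → numeral k ∈ w
  numerals-bounded with infinity
  ... | w , _ , (e , e∈w , e-empty) , w-closed = w , numeral∈w
    where
    numeral∈w : ∀ k → numeral k ∈ w
    numeral∈w zero = subst (_∈ w) (IsEmptySet-unique e-empty ∅-empty) e∈w
    numeral∈w (suc k) with w-closed (numeral k) (numeral∈w k)
    ... | s , s∈w , s-is = subst (_∈ w) (IsSetOf-unique s-is (IsSucc-⁺ (numeral k))) s∈w

  ⁺-injective : ∀ {α β} → Transitive α → α ⁺ ≡ β ⁺ → α ≡ β
  ⁺-injective {α} {β} α-trans α⁺≡β⁺
    with ∈-elim (IsSucc-⁺ β) (subst (α ∈_) α⁺≡β⁺ ∈-⁺)
       | ∈-elim (IsSucc-⁺ α) (subst (β ∈_) (sym α⁺≡β⁺) ∈-⁺)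
  ... | inj₂ α≡β | _ = α≡β
  ... | inj₁ _ | inj₂ β≡α = sym β≡α
  ... | inj₁ α∈β | inj₁ β∈α = ⊥-elim (∈-irrefl α (∈-trans α-trans α∈β β∈α))

  numeral-injective : ∀ {k m} → numeral k ≡ numeral m → k ≡ m
  numeral-injective {zero} {zero} _ = refl
  numeral-injective {zero} {suc m} ∅≡m⁺ =
    ⊥-elim (proj₂ ∅-empty _ (subst (numeral m ∈_) (sym ∅≡m⁺) ∈-⁺))
  numeral-injective {suc k} {zero} k⁺≡∅ =
    ⊥-elim (proj₂ ∅-empty _ (subst (numeral k ∈_) k⁺≡∅ ∈-⁺))
  numeral-injective {suc k} {suc m} k⁺≡m⁺ =
    cong suc (numeral-injective (⁺-injective (proj₁ (Ordinal-fold Ordinal-∅ k)) k⁺≡m⁺))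

  -- Replacement over an infinite set, sending numeral k to c k and every
  -- other element to the junk value c 0.
  ⋃ℕ : (c : ℕ → U) → SetOf (λ γ → ∃ λ k → γ ∈ c k)
  ⋃ℕ c with numerals-bounded
  ... | w , numeral∈w = SetOf-⟺ (λ γ → to , from) (union img)
    where
    term : ∀ {x} → Dec (∃ λ k → x ≡ numeral k) → U
    term (yes (k , _)) = c k
    term (no _) = c zero
    F : U → U
    F x = term (excluded-middle (∃ λ k → x ≡ numeral k))
    img : U
    img = proj₁ (replacement F w)
    img-is : IsSetOf (λ y → ∃ λ x → x ∈ w × y ≡ F x) img
    img-is = proj₂ (replacement F w)
    term-in-range : ∀ {x} (d : Dec (∃ λ k → x ≡ numeral k)) → ∃ λ k → term d ≡ c k
    term-in-range (yes (k , _)) = k , refl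
    term-in-range (no _) = zero , refl
    term-numeral : ∀ k (d : Dec (∃ λ m → numeral k ≡ numeral m)) → term d ≡ c k
    term-numeral k (yes (m , k≡m)) = cong c (sym (numeral-injective k≡m))
    term-numeral k (no ¬k) = ⊥-elim (¬k (k , refl))
    to : ∀ {γ} → (∃ λ y → y ∈ img × γ ∈ y) → ∃ λ k → γ ∈ c k
    to {γ} (y , y∈img , γ∈y) with ∈-elim img-is y∈img
    ... | x , _ , refl with term-in-range (excluded-middle (∃ λ k → x ≡ numeral k))
    ...   | k , Fx≡ck = k , subst (γ ∈_) Fx≡ck γ∈y
    from : ∀ {γ} → (∃ λ k → γ ∈ c k) → ∃ λ y → y ∈ img × γ ∈ y
    from {γ} (k , γ∈ck) = F (numeral k) , ∈-intro img-is (numeral k , numeral∈w k , refl)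
                        , subst (γ ∈_) (sym (term-numeral k (excluded-middle _))) γ∈ck

  ⋃-chain-IsLimit : ∀ {L} (c : ℕ → U) → (∀ k → Ordinal (c k)) → (∀ k → c k ∈ c (suc k)) →
                    IsSetOf (λ γ → ∃ λ k → γ ∈ c k) L → IsLimit L
  ⋃-chain-IsLimit {L} c oc c-chain L-is =
      Ordinal-⋃ (proj₁ L-is) (λ γ∈L → let (k , γ∈ck) = ∈-elim L-is γ∈L in c k , oc k , γ∈ck , ck⊆L k)
    , (c zero , ∈-intro L-is (1 , c-chain 0))
    , λ γ γ∈L → let (k , γ∈ck) = ∈-elim L-is γ∈L in c k , ∈-intro L-is (suc k , c-chain k) , γ∈ck
    where
    ck⊆L : ∀ k → c k ⊆ L
    ck⊆L k z z∈ck = ∈-intro L-is (k , z∈ck)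

  limit-above : ∀ {β γ} → Ordinal β → Ordinal γ → ∃ λ λ′ → IsLimit λ′ × β ∈ λ′ × γ ∈ λ′
  limit-above {β} {γ} oβ oγ with binary-union (β ⁺) (γ ⁺)
  ... | δ , δ-is with ⋃ℕ (fold δ _⁺)
  ...   | L , L-is = L , ⋃-chain-IsLimit (fold δ _⁺) (Ordinal-fold oδ) (λ _ → ∈-⁺) L-is
                   , δ⊆L (inj₁ ∈-⁺) , δ⊆L (inj₂ ∈-⁺)
    where
    oδ = Ordinal-∪ (Ordinal-⁺ oβ) (Ordinal-⁺ oγ) δ-is
    δ⊆L : ∀ {z} → z ∈ β ⁺ ⊎ z ∈ γ ⁺ → z ∈ L
    δ⊆L z∈δ = ∈-intro L-is (0 , ∈-intro δ-is z∈δ)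

module MagmaticPairs (S : Setup) where
  open Setup S using (Z; _≼_; ≼-refl; ≼-trans; a₀-atom; a₁-atom; a₀⋠a₁; a₁⋠a₀)
  open Magmatic S
  open SetTheory Z

  Mst-nonatom : ∀ {α x} → Ordinal α → NonEmpty α → Mst α x → ¬ Atom x
  Mst-nonatom {α} = go (foundation α)
    where
    go : ∀ {α x} → Acc _∈_ α → Ordinal α → NonEmpty α → Mst α x → ¬ Atom x
    go (acc rs) oα α-ne x∈Mα with shape oα α-ne
    ... | one α-one = proj₁ (proj₁ (clause-one _ α-one _) x∈Mα)
    ... | succ oγ γ-ne α-succ = proj₁ (proj₁ (clause-succ _ _ oγ γ-ne α-succ _) x∈Mα)
    ... | limit α-limit with proj₁ (clause-limit _ α-limit _) x∈Mα
    ...   | β , β∈α , β-ne , x∈Mβ = go (rs β∈α) (Ordinal-∈ oα β∈α) β-ne x∈Mβ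

  M-nonatom : ∀ {x} → M x → ¬ Atom x
  M-nonatom (_ , oα , α-ne , x∈Mα) = Mst-nonatom oα α-ne x∈Mα

  Mst-limit : ∀ {λ′ β x} → IsLimit λ′ → β ∈ λ′ → NonEmpty β → Mst β x → Mst λ′ x
  Mst-limit λ-limit β∈λ β-ne x∈Mβ = proj₂ (clause-limit _ λ-limit _) (_ , β∈λ , β-ne , x∈Mβ)

  M-⁺ : ∀ {α x} → Ordinal α → Mst (α ⁺) x → M x
  M-⁺ {α} oα x∈Mα⁺ = α ⁺ , Ordinal-⁺ oα , (α , ∈-⁺) , x∈Mα⁺

  Mst-⁺-downset : ∀ {α b s₀} → Ordinal α → NonEmpty α → (P : U → Set) →
                  (∀ {s} → P s → s ⊆ b) → (∀ {s r} → P s → r ⊆ s → P r) → Mst α s₀ → P s₀ →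
                  ∃ λ t → Mst (α ⁺) t × IsSetOf (λ s → Mst α s × P s) t
  Mst-⁺-downset {α} {b} {s₀} oα α-ne P bounded downward s₀∈Mα Ps₀
    with comprehension (λ s → Mst α s × P s) b (λ p → bounded (proj₂ p))
  ... | t , t-is =
        t , proj₂ (clause-succ α (α ⁺) oα α-ne (IsSucc-⁺ α) t)
              ( proj₁ t-is , (s₀ , ∈-intro t-is (s₀∈Mα , Ps₀))
              , (λ s s∈t → proj₁ (∈-elim t-is s∈t))
              , λ s r s∈t r∈Mα r⊆s → ∈-intro t-is (r∈Mα , downward (proj₂ (∈-elim t-is s∈t)) r⊆s))
          , t-is

  M-∋-within-pr : ∀ {u} → M u → ∃ λ t → M t × u ∈ t × el t ⊆C pr (el u)
  M-∋-within-pr {u} (α , oα , α-ne , u∈Mα)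
    with Mst-⁺-downset oα α-ne (_⊆ u) (λ s⊆u → s⊆u) (λ s⊆u r⊆s → ⊆-trans r⊆s s⊆u) u∈Mα ⊆-refl
  ... | t , t∈Mα⁺ , t-is =
        t , M-⁺ oα t∈Mα⁺ , ∈-intro t-is (u∈Mα , ⊆-refl)
          , λ s s∈t → let (s∈Mα , s⊆u) = ∈-elim t-is s∈t in (α , oα , α-ne , s∈Mα) , s⊆u

  M-∋-within-prA : ∀ {a} → Atom a → ∃ λ t → M t × a ∈ t × el t ⊆C prA a
  M-∋-within-prA {a} a-atom with comprehension (prA a) ∅ (λ (b-atom , _) z z∈b → ⊥-elim (atom-empty _ b-atom z z∈b))
  ... | t , t-is = t , (∅ ⁺ , Ordinal-⁺ Ordinal-∅ , (∅ , ∈-⁺) , proj₂ (clause-one _ ∅⁺-IsOne t) M₁-t)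
                 , a∈t , λ b → ∈-elim t-is
    where
    a∈t = ∈-intro t-is (a-atom , ≼-refl a a-atom)
    M₁-t : M₁-cond t
    M₁-t = proj₁ t-is , (a , a∈t) , (λ b b∈t → proj₁ (∈-elim t-is b∈t))
         , λ c b c∈t b-atom b≼c → let (c-atom , c≼a) = ∈-elim t-is c∈t in
                                  ∈-intro t-is (b-atom , ≼-trans b c a b-atom c-atom a-atom b≼c c≼a)

  pr-mono : ∀ {C D} → C ⊆C D → pr C ⊆C pr D
  pr-mono C⊆D s (Ms , s⊆C) = Ms , λ r r∈s → C⊆D r (s⊆C r r∈s)

  pair-witness : ∀ {p q} → M p → M q →
                 ∃ λ y → pr (pr (pr (el p) ∪ pr (el q))) y × ∃ λ v → v ∈ y × p ∈ v × q ∈ v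
  pair-witness {p} {q} (β , oβ , β-ne , p∈Mβ) (γ , oγ , γ-ne , q∈Mγ)
    with limit-above oβ oγ | binary-union p q
  ... | λ′ , λ-limit@(oλ , λ-ne , _) , β∈λ , γ∈λ | _ , p∪q-is
    with Mst-⁺-downset oλ λ-ne (λ s → s ⊆ p ⊎ s ⊆ q) (⊆-∪ p∪q-is)
           (λ s⊆p∪q r⊆s → Sum.map (⊆-trans r⊆s) (⊆-trans r⊆s) s⊆p∪q)
           (Mst-limit λ-limit β∈λ β-ne p∈Mβ) (inj₁ ⊆-refl)
  ... | v , v∈Mλ⁺ , v-is with M-∋-within-pr (M-⁺ oλ v∈Mλ⁺)
  ... | y , My , v∈y , y⊆pr-v =
        y , (My , y⊆) , v , v∈y , ∈-intro v-is (Mst-limit λ-limit β∈λ β-ne p∈Mβ , inj₁ ⊆-refl)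
                                , ∈-intro v-is (Mst-limit λ-limit γ∈λ γ-ne q∈Mγ , inj₂ ⊆-refl)
    where
    y⊆ : el y ⊆C pr (pr (el p) ∪ pr (el q))
    y⊆ s s∈y = let (Ms , s⊆v) = y⊆pr-v s s∈y in Ms , λ r r∈s →
      let (r∈Mλ , r⊆p∪q) = ∈-elim v-is (s⊆v r r∈s)
          Mr = λ′ , oλ , λ-ne , r∈Mλ
      in Sum.map (Mr ,_) (Mr ,_) r⊆p∪q

  tag : U → U → Class
  tag x a = pr (pr² x ∪ pr²A a)

  tag-sets : ∀ {u t v x a} → M u → u ∈ t → t ∈ v → tag x a v → u ⊆ x
  tag-sets Mu u∈t t∈v (_ , v⊆) with v⊆ _ t∈v
  ... | inj₁ (_ , t⊆pr-x) = proj₂ (t⊆pr-x _ u∈t)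
  ... | inj₂ (_ , t⊆prA-a) = ⊥-elim (M-nonatom Mu (proj₁ (t⊆prA-a _ u∈t)))

  tag-atoms : ∀ {b t v x a} → Atom b → b ∈ t → t ∈ v → tag x a v → b ≼ a
  tag-atoms b-atom b∈t t∈v (_ , v⊆) with v⊆ _ t∈v
  ... | inj₁ (_ , t⊆pr-x) = ⊥-elim (M-nonatom (proj₁ (t⊆pr-x _ b∈t)) b-atom)
  ... | inj₂ (_ , t⊆prA-a) = proj₂ (t⊆prA-a _ b∈t)

  pr-tag-separates : ∀ {a a′ x u} → Atom a → ¬ (a ≼ a′) → pr (el x) u →
    ∃ λ y → pr (tag x a) y × ∀ {x′ y′} → pr (tag x′ a ∪ tag y′ a′) y → pr (el x′) u
  pr-tag-separates {a} {a′} {x} {u} a-atom a⋠a′ (Mu , u⊆x) =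
    let (t , Mt , u∈t , t⊆pr-u) = M-∋-within-pr Mu
        (t₀ , Mt₀ , a∈t₀ , t₀⊆prA-a) = M-∋-within-prA a-atom
        (y , y∈pr³ , v , v∈y , t∈v , t₀∈v) = pair-witness Mt Mt₀
        t⊆pr-x : el t ⊆C pr (el x)
        t⊆pr-x s s∈t = pr-mono u⊆x s (t⊆pr-u s s∈t)
        y∈pr-tag : pr (tag x a) y
        y∈pr-tag = pr-mono (pr-mono (λ s → Sum.map (pr-mono t⊆pr-x s) (pr-mono t₀⊆prA-a s))) y y∈pr³
        reflect : ∀ {x′ y′} → pr (tag x′ a ∪ tag y′ a′) y → pr (el x′) u
        reflect (_ , y⊆) = [ (λ v∈tag → Mu , tag-sets Mu u∈t t∈v v∈tag)
                           , (λ v∈tag → ⊥-elim (a⋠a′ (tag-atoms a-atom a∈t₀ t₀∈v v∈tag))) ]′ (y⊆ v v∈y)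
    in y , y∈pr-tag , reflect

  module _ {I : U} (z w : U → U) (zw∈M : ∀ i → i ∈ I → M (z i) × M (w i)) where
    R : Class
    R u = ∃ λ i → i ∈ I × pr ⟪ z i , w i ⟫ u

    pr-pair⊆R : ∀ {i} → i ∈ I → pr ⟪ z i , w i ⟫ ⊆C R
    pr-pair⊆R i∈I s s∈pr = _ , i∈I , s∈pr

    dom-R : ∀ u → dom R u ⟺ (∃ λ i → i ∈ I × pr (el (z i)) u)
    dom-R u = to , from
      where
      to : dom R u → ∃ λ i → i ∈ I × pr (el (z i)) u
      to (_ , _ , (_ , _ , pr-pair⊆R′) , u∈pr) =
        let (y , y∈pr-tag , reflect) = pr-tag-separates a₀-atom a₀⋠a₁ u∈pr
            (i , i∈I , y∈pr-pair) = pr-pair⊆R′ y (pr-mono (λ _ → inj₁) y y∈pr-tag)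
        in i , i∈I , reflect y∈pr-pair
      from : (∃ λ i → i ∈ I × pr (el (z i)) u) → dom R u
      from (i , i∈I , u∈pr) = z i , proj₁ (zw∈M i i∈I) , (w i , proj₂ (zw∈M i i∈I) , pr-pair⊆R i∈I) , u∈pr

    ran-R : ∀ u → ran R u ⟺ (∃ λ i → i ∈ I × pr (el (w i)) u)
    ran-R u = to , from
      where
      to : ran R u → ∃ λ i → i ∈ I × pr (el (w i)) u
      to (_ , _ , (_ , _ , pr-pair⊆R′) , u∈pr) =
        let (y , y∈pr-tag , reflect) = pr-tag-separates a₁-atom a₁⋠a₀ u∈pr
            (i , i∈I , y∈pr-pair) = pr-pair⊆R′ y (pr-mono (λ _ → inj₂) y y∈pr-tag)
        in i , i∈I , reflect (pr-mono (λ _ → swap) y y∈pr-pair)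
      from : (∃ λ i → i ∈ I × pr (el (w i)) u) → ran R u
      from (i , i∈I , u∈pr) = w i , proj₂ (zw∈M i i∈I) , (z i , proj₁ (zw∈M i i∈I) , pr-pair⊆R i∈I) , u∈pr

fact4p5 : (S : Setup) → let open Magmatic S in
    (I : U) → NonEmpty I → (z w : U → U) → (∀ i → i ∈ I → M (z i) × M (w i)) →
    let R : Class
        R u = ∃ λ i → i ∈ I × pr ⟪ z i , w i ⟫ u
    in (∀ u → dom R u ⟺ (∃ λ i → i ∈ I × pr (el (z i)) u)) ×
    (∀ u → ran R u ⟺ (∃ λ i → i ∈ I × pr (el (w i)) u))
fact4p5 S I _ z w zw∈M = dom-R z w zw∈M , ran-R z w zw∈M
  where open MagmaticPairs S
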